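{- A Sharing Nim position $(x,y,z)$ with $x\le y\le z$ is a $\mathcal{P}$-position if and only if $(0,y-x,z-x)$ belongs to the set \[\{(0,0,0)\}\cup\{(0,0,2^{2k}(2l+1)),\ (0,2^{2k}(2l+1),2^{2k}(2l+1)) : k\ge 0,\ l\ge 0\}.\] Equivalently, the $\mathcal{P}$-positions are exactly those in which either all three piles are equal, or two piles are equal and the difference between the remaining pile and these two is of the form $\pm 2^{2k}(2l+1)$ with $k,l\ge 0$.
   Context: Three-pile Sharing Nim: a position is a triple of nonnegative integers (pile sizes; order irrelevant). A move takes some positive number $k$ of tokens from one pile and adds them to another pile, provided that after the move the receiving pile does not have more tokens than the source pile; i.e. from $(a,b,c)$ with $a\le b\le c$ one may move to $(a+k,b-k,c)$ with $1\le k\le (b-a)/2$, to $(a+k,b,c-k)$ with $1\le k\le (c-a)/2$, or to $(a,b+k,c-k)$ with $1\le k\le (c-b)/2$. Players alternate, and the player who cannot move loses (normal play). A $\mathcal{P}$-position is a position from which the player who is about to move has no winning strategy (equivalently, its Sprague–Grundy value is $0$). -}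

module Defs where

open import Data.Nat using (ℕ; zero; suc; _+_; _*_; _^_; _≤_; _<_)
open import Data.Product using (_×_; _,_; Σ; ∃; ∃-syntax)
open import Relation.Binary.PropositionalEquality using (_≡_)
open import Relation.Nullary using (¬_)

Pos : Set
Pos = ℕ × ℕ × ℕ

-- One move of Sharing Nim: move k ≥ 1 tokens from a source pile (which holds
-- s + k tokens, leaving s) to a receiving pile (holding r, getting r + k),
-- allowed only if afterwards r + k ≤ s.
data Move : Pos → Pos → Set where
  m21 : ∀ {a b c k} → 0 < k → a + k ≤ b → Move (a , b + k , c) (a + k , b , c)
  m31 : ∀ {a b c k} → 0 < k → a + k ≤ c → Move (a , b , c + k) (a + k , b , c)
  m12 : ∀ {a b c k} → 0 < k → b + k ≤ a → Move (a + k , b , c) (a , b + k , c)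
  m32 : ∀ {a b c k} → 0 < k → b + k ≤ c → Move (a , b , c + k) (a , b + k , c)
  m13 : ∀ {a b c k} → 0 < k → c + k ≤ a → Move (a + k , b , c) (a , b , c + k)
  m23 : ∀ {a b c k} → 0 < k → c + k ≤ b → Move (a , b + k , c) (a , b , c + k)

data Win (p : Pos) : Set where
  win : (q : Pos) → Move p q → ((r : Pos) → Move q r → Win r) → Win p

IsP : Pos → Set
IsP p = ¬ Win p

Form : ℕ → Set
Form n = ∃[ k ] ∃[ l ] (n ≡ 2 ^ (2 * k) * (2 * l + 1))

data InSet : Pos → Set where
  zzz : InSet (0 , 0 , 0)
  zzm : ∀ {m} → Form m → InSet (0 , 0 , m)
  zmm : ∀ {m} → Form m → InSet (0 , m , m)

-- Call PSet the positions in which two piles are equal and the third differs from them by 0 or by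
-- a number 4ᵏ(2l+1).  No move leads from PSet to PSet: such a move would transfer k tokens across
-- a gap of 2k with both k and 2k of the form 4ᵏ(2l+1), although their 2-adic valuations differ by
-- one.  Every position reaches PSet in at most one move: transfer from the largest pile to the
-- smallest until the latter equals the middle one, or, if the gap left over is 2n with n of the
-- good form, transfer n more so that this gap is halved.  Every move lowers the sum of the squares
-- of the piles, so play terminates and PSet is exactly the set of P-positions; translating by the
-- smallest pile turns PSet into the set of the statement.

module Submission where

open import Defs
open import Data.Empty using (⊥; ⊥-elim)
open import Data.List using ([]; _∷_)
open import Data.Nat using (ℕ; zero; suc; _+_; _*_; _^_; _≤_; _<_; _∸_; z≤n; z<s; ⌊_/2⌋; ⌈_/2⌉; >-nonZero)
open import Data.Nat.Induction using (<-wellFounded)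
open import Data.Nat.Properties
open import Algebra.Properties.CommutativeSemigroup +-commutativeSemigroup
  using (xy∙z≈yx∙z; xy∙z≈xz∙y)
open import Data.Nat.Tactic.RingSolver using (solve-∀; solve)
open import Data.Product using (_×_; _,_; ∃-syntax)
open import Data.Sum using (_⊎_; inj₁; inj₂; fromInj₁)
open import Function.Base using (_∘_)
open import Function.Bundles using (_⇔_; mk⇔; Equivalence)
import Function.Properties.Equivalence as ⇔
open import Induction.WellFounded using (Acc; acc)
open import Relation.Binary.Construct.Closure.Reflexive using (ReflClosure; refl; [_])
import Relation.Binary.Construct.Closure.Reflexive as ReflClosure
open import Relation.Binary.PropositionalEquality
  using (_≡_; _≢_; refl; sym; trans; cong; cong₂; subst; subst₂; module ≡-Reasoning)
open import Relation.Nullary using (¬_)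

variable
  a a′ b c c′ j k m n : ℕ
  p q : Pos

m+n≤o⇒m<o : ∀ m {n o} → 0 < n → m + n ≤ o → m < o
m+n≤o⇒m<o m n>0 m+n≤o = <-≤-trans (m<m+n m n>0) m+n≤o

odd≢double : ∀ l k → suc (l + l) ≢ k + k
odd≢double l k eq = 1+n≢n (begin
  suc l              ≡⟨ cong suc (n≡⌊n+n/2⌋ l) ⟩
  ⌈ suc (l + l) /2⌉  ≡⟨ cong ⌈_/2⌉ eq ⟩
  ⌈ k + k /2⌉        ≡⟨ n≡⌈n+n/2⌉ k ⟨
  k                  ≡⟨ n≡⌊n+n/2⌋ k ⟩
  ⌊ k + k /2⌋        ≡⟨ cong ⌊_/2⌋ eq ⟨
  ⌈ l + l /2⌉        ≡⟨ n≡⌈n+n/2⌉ l ⟨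
  l                  ∎)
  where open ≡-Reasoning

double-injective : m + m ≡ n + n → m ≡ n
double-injective {m} {n} eq = trans (n≡⌊n+n/2⌋ m) (trans (cong ⌊_/2⌋ eq) (sym (n≡⌊n+n/2⌋ n)))

data Parity : ℕ → Set where
  even : ∀ h → Parity (h + h)
  odd  : ∀ h → Parity (suc (h + h))

parity : ∀ n → Parity n
parity zero = even 0
parity (suc n) with parity n
... | even h = odd h
... | odd h  = subst Parity (cong suc (+-suc h h)) (even (suc h))

-- EvenVal n: n = 4ᵏ(2l+1), i.e. n > 0 and the 2-adic valuation of n is even.
data EvenVal : ℕ → Set where
  odd       : ∀ l → EvenVal (suc (l + l))
  quadruple : EvenVal n → EvenVal ((n + n) + (n + n))

EvenVal-positive : EvenVal n → 0 < n
EvenVal-positive (odd l) = z<s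
EvenVal-positive (quadruple {n} e) =
  <-≤-trans (EvenVal-positive e) (≤-trans (m≤m+n n n) (m≤m+n (n + n) (n + n)))

EvenVal-double⇒¬EvenVal : EvenVal (n + n) → ¬ EvenVal n
EvenVal-double⇒¬EvenVal = go refl
  where
  go : m ≡ n + n → EvenVal m → ¬ EvenVal n
  go {n = n} eq (odd l) _ = odd≢double l n eq
  go {n = n} eq (quadruple {h} e) e′ with double-injective {h + h} {n} eq
  ... | refl = go refl e′ e

data ValuationView : ℕ → Set where
  zero    : ValuationView 0
  evenVal : EvenVal n → ValuationView n
  oddVal  : EvenVal n → ValuationView (n + n)

double-view : ValuationView n → ValuationView (n + n)
double-view zero        = zero
double-view (evenVal e) = oddVal e
double-view (oddVal e)  = evenVal (quadruple e)

valuationView : ∀ n → ValuationView n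
valuationView n = go n (<-wellFounded n)
  where
  go : ∀ n → Acc _<_ n → ValuationView n
  go n _ with parity n
  go _ _        | odd h        = evenVal (odd h)
  go _ _        | even zero    = zero
  go _ (acc rs) | even (suc h) = double-view (go (suc h) (rs (m<m+n (suc h) z<s)))

pow4-suc : ∀ k → 2 ^ (2 * suc k) ≡ 4 * 2 ^ (2 * k)
pow4-suc k = begin
  2 ^ (2 * suc k)    ≡⟨ ^-*-assoc 2 2 (suc k) ⟨
  4 * (2 ^ 2) ^ k    ≡⟨ cong (4 *_) (^-*-assoc 2 2 k) ⟩
  4 * 2 ^ (2 * k)    ∎
  where open ≡-Reasoning

Form-suc : ∀ k b → 2 ^ (2 * suc k) * b ≡ let t = 2 ^ (2 * k) * b in (t + t) + (t + t)
Form-suc k b = trans (cong (_* b) (pow4-suc k)) (quadruple-sum (2 ^ (2 * k)) b)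
  where
  quadruple-sum : ∀ p b → 4 * p * b ≡ (p * b + p * b) + (p * b + p * b)
  quadruple-sum = solve-∀

odd-Form : ∀ l → suc (l + l) ≡ 2 ^ (2 * 0) * (2 * l + 1)
odd-Form = solve-∀

EvenVal⇒Form : EvenVal n → Form n
EvenVal⇒Form (odd l) = 0 , l , odd-Form l
EvenVal⇒Form (quadruple e) with EvenVal⇒Form e
... | k , l , refl = suc k , l , sym (Form-suc k (2 * l + 1))

Form⇒EvenVal : Form n → EvenVal n
Form⇒EvenVal (k , l , refl) = go k l
  where
  go : ∀ k l → EvenVal (2 ^ (2 * k) * (2 * l + 1))
  go zero    l = subst EvenVal (odd-Form l) (odd l)
  go (suc k) l = subst EvenVal (sym (Form-suc k (2 * l + 1))) (quadruple (go k l))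

data EvenGap (e t : ℕ) : Set where
  same  : t ≡ e → EvenGap e t
  above : EvenVal m → t ≡ e + m → EvenGap e t
  below : EvenVal m → e ≡ t + m → EvenGap e t

data PSet : Pos → Set where
  twin₁₂ : a ≡ b → EvenGap a c → PSet (a , b , c)
  twin₁₃ : a ≡ c → EvenGap a b → PSet (a , b , c)
  twin₂₃ : b ≡ c → EvenGap b a → PSet (a , b , c)

swap₁₂ swap₂₃ : Pos → Pos
swap₁₂ (a , b , c) = (b , a , c)
swap₂₃ (a , b , c) = (a , c , b)

PSet-swap₁₂ : PSet p → PSet (swap₁₂ p)
PSet-swap₁₂ (twin₁₂ refl g) = twin₁₂ refl g
PSet-swap₁₂ (twin₁₃ eq g)   = twin₂₃ eq g
PSet-swap₁₂ (twin₂₃ eq g)   = twin₁₃ eq g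

PSet-swap₂₃ : PSet p → PSet (swap₂₃ p)
PSet-swap₂₃ (twin₁₂ eq g)   = twin₁₃ eq g
PSet-swap₂₃ (twin₁₃ eq g)   = twin₁₂ eq g
PSet-swap₂₃ (twin₂₃ refl g) = twin₂₃ refl g

Move-swap₁₂ : Move p q → Move (swap₁₂ p) (swap₁₂ q)
Move-swap₁₂ (m21 k>0 le) = m12 k>0 le
Move-swap₁₂ (m31 k>0 le) = m32 k>0 le
Move-swap₁₂ (m12 k>0 le) = m21 k>0 le
Move-swap₁₂ (m32 k>0 le) = m31 k>0 le
Move-swap₁₂ (m13 k>0 le) = m23 k>0 le
Move-swap₁₂ (m23 k>0 le) = m13 k>0 le

Move-swap₂₃ : Move p q → Move (swap₂₃ p) (swap₂₃ q)
Move-swap₂₃ (m21 k>0 le) = m31 k>0 le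
Move-swap₂₃ (m31 k>0 le) = m21 k>0 le
Move-swap₂₃ (m12 k>0 le) = m13 k>0 le
Move-swap₂₃ (m32 k>0 le) = m23 k>0 le
Move-swap₂₃ (m13 k>0 le) = m12 k>0 le
Move-swap₂₃ (m23 k>0 le) = m32 k>0 le

module _ (R : Pos → Pos → Set)
         (R-swap₁₂ : ∀ {p q} → R p q → R (swap₁₂ p) (swap₁₂ q))
         (R-swap₂₃ : ∀ {p q} → R p q → R (swap₂₃ p) (swap₂₃ q))
         (R-transfer₂₁ : ∀ {a b c k} → 0 < k → a + k ≤ b → R (a , b + k , c) (a + k , b , c))
         where

  Move-elim : Move p q → R p q
  Move-elim (m21 k>0 le) = R-transfer₂₁ k>0 le
  Move-elim (m12 k>0 le) = R-swap₁₂ (R-transfer₂₁ k>0 le)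
  Move-elim (m31 k>0 le) = R-swap₂₃ (R-transfer₂₁ k>0 le)
  Move-elim (m13 k>0 le) = R-swap₂₃ (R-swap₁₂ (R-transfer₂₁ k>0 le))
  Move-elim (m32 k>0 le) = R-swap₁₂ (R-swap₂₃ (R-transfer₂₁ k>0 le))
  Move-elim (m23 k>0 le) = R-swap₁₂ (R-swap₂₃ (R-swap₁₂ (R-transfer₂₁ k>0 le)))

PSet-unequal : PSet (a , b , c) → a < b →
               ∃[ m ] EvenVal m × b ≡ a + m × (c ≡ a ⊎ c ≡ b)
PSet-unequal (twin₁₂ a≡b _)              a<b = ⊥-elim (<⇒≢ a<b a≡b)
PSet-unequal (twin₁₃ _ (same b≡a))       a<b = ⊥-elim (<⇒≢ a<b (sym b≡a))
PSet-unequal (twin₁₃ a≡c (above e b≡a+m)) _  = _ , e , b≡a+m , inj₁ (sym a≡c)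
PSet-unequal (twin₁₃ _ (below {m} _ a≡b+m)) a<b =
  ⊥-elim (<⇒≢ (<-≤-trans a<b (m≤m+n _ m)) a≡b+m)
PSet-unequal (twin₂₃ _ (same a≡b))       a<b = ⊥-elim (<⇒≢ a<b a≡b)
PSet-unequal (twin₂₃ _ (above {m} _ a≡b+m)) a<b =
  ⊥-elim (<⇒≢ (<-≤-trans a<b (m≤m+n _ m)) a≡b+m)
PSet-unequal (twin₂₃ b≡c (below e b≡a+m)) _  = _ , e , b≡a+m , inj₂ (sym b≡c)

EvenGap-doubled : EvenVal m → EvenVal k → a + k ≡ b → b + k ≡ a + m → ⊥
EvenGap-doubled {m} {k} {a} {b} ev-m ev-k a+k≡b b+k≡a+m =
  EvenVal-double⇒¬EvenVal (subst EvenVal m≡k+k ev-m) ev-k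
  where
  m≡k+k : m ≡ k + k
  m≡k+k = +-cancelˡ-≡ a m (k + k) (begin
    a + m        ≡⟨ b+k≡a+m ⟨
    b + k        ≡⟨ cong (_+ k) a+k≡b ⟨
    a + k + k    ≡⟨ +-assoc a k k ⟩
    a + (k + k)  ∎)
    where open ≡-Reasoning

-- Before the move the receiver and the source differ by some m ∈ EvenVal; after it, two piles
-- differ by k, which forces k ∈ EvenVal and m = k + k.
PSet-no-transfer₂₁ : 0 < k → a + k ≤ b → PSet (a , b + k , c) → ¬ PSet (a + k , b , c)
PSet-no-transfer₂₁ {k} {a} {b} k>0 a+k≤b before after
  with PSet-unequal before (<-≤-trans (m+n≤o⇒m<o a k>0 a+k≤b) (m≤m+n b k))
... | m , ev-m , b+k≡a+m , inj₁ refl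
  with PSet-unequal (PSet-swap₁₂ (PSet-swap₂₃ after)) (m<m+n a k>0)
...   | _ , _ , _ , inj₁ b≡a = <⇒≢ (m+n≤o⇒m<o a k>0 a+k≤b) (sym b≡a)
...   | k′ , ev-k′ , a+k≡a+k′ , inj₂ b≡a+k =
  EvenGap-doubled ev-m (subst EvenVal (sym (+-cancelˡ-≡ a k k′ a+k≡a+k′)) ev-k′)
                  (sym b≡a+k) b+k≡a+m
PSet-no-transfer₂₁ {k} {a} {b} k>0 a+k≤b before after | m , ev-m , b+k≡a+m , inj₂ refl
  with PSet-unequal (PSet-swap₂₃ (PSet-swap₁₂ after)) (m<m+n b k>0)
...   | k′ , ev-k′ , b+k≡b+k′ , inj₁ a+k≡b =
  EvenGap-doubled ev-m (subst EvenVal (sym (+-cancelˡ-≡ b k k′ b+k≡b+k′)) ev-k′)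
                  a+k≡b b+k≡a+m
...   | _ , _ , _ , inj₂ a+k≡b+k = <⇒≢ (m+n≤o⇒m<o a k>0 a+k≤b) (+-cancelʳ-≡ k a b a+k≡b+k)

PSet-independent : Move p q → PSet p → ¬ PSet q
PSet-independent = Move-elim (λ p q → PSet p → ¬ PSet q)
  (λ ¬both P Q → ¬both (PSet-swap₁₂ P) (PSet-swap₁₂ Q))
  (λ ¬both P Q → ¬both (PSet-swap₂₃ P) (PSet-swap₂₃ Q))
  PSet-no-transfer₂₁

sumSq : Pos → ℕ
sumSq (a , b , c) = a * a + b * b + c * c

sumSq-swap₁₂ : ∀ p → sumSq (swap₁₂ p) ≡ sumSq p
sumSq-swap₁₂ (a , b , c) = xy∙z≈yx∙z (b * b) (a * a) (c * c)

sumSq-swap₂₃ : ∀ p → sumSq (swap₂₃ p) ≡ sumSq p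
sumSq-swap₂₃ (a , b , c) = xy∙z≈xz∙y (a * a) (c * c) (b * b)

sumSq-transfer₂₁ : 0 < k → a + k ≤ b → sumSq (a + k , b , c) < sumSq (a , b + k , c)
sumSq-transfer₂₁ {k} {a} {b} {c} k>0 a+k≤b = begin-strict
  (a + k) * (a + k) + b * b + c * c        ≡⟨ solve (a ∷ b ∷ c ∷ k ∷ []) ⟩
  a * a + b * b + c * c + k * (a + a + k)  <⟨ +-monoʳ-< (a * a + b * b + c * c)
                                                (*-monoʳ-< k {{>-nonZero k>0}} (+-monoˡ-< k (+-mono-< a<b a<b))) ⟩
  a * a + b * b + c * c + k * (b + b + k)  ≡⟨ solve (a ∷ b ∷ c ∷ k ∷ []) ⟩
  a * a + (b + k) * (b + k) + c * c        ∎
  where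
  open ≤-Reasoning
  a<b : a < b
  a<b = m+n≤o⇒m<o a k>0 a+k≤b

sumSq-decreasing : Move p q → sumSq q < sumSq p
sumSq-decreasing = Move-elim (λ p q → sumSq q < sumSq p)
  (λ {p} {q} lt → subst₂ _<_ (sym (sumSq-swap₁₂ q)) (sym (sumSq-swap₁₂ p)) lt)
  (λ {p} {q} lt → subst₂ _<_ (sym (sumSq-swap₂₃ q)) (sym (sumSq-swap₂₃ p)) lt)
  (λ {a} {b} {c} → sumSq-transfer₂₁ {c = c})

sorted-elim : (P : Pos → Set) → (∀ {p} → P p → P (swap₁₂ p)) → (∀ {p} → P p → P (swap₂₃ p)) →
              (∀ {a b c} → a ≤ b → b ≤ c → P (a , b , c)) → ∀ p → P p
sorted-elim P P-swap₁₂ P-swap₂₃ sorted (a , b , c) with ≤-total a b | ≤-total b c | ≤-total a c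
... | inj₁ a≤b | inj₁ b≤c | _        = sorted a≤b b≤c
... | inj₁ a≤b | inj₂ c≤b | inj₁ a≤c = P-swap₂₃ (sorted a≤c c≤b)
... | inj₁ a≤b | inj₂ c≤b | inj₂ c≤a = P-swap₂₃ (P-swap₁₂ (sorted c≤a a≤b))
... | inj₂ b≤a | inj₁ b≤c | inj₁ a≤c = P-swap₁₂ (sorted b≤a a≤c)
... | inj₂ b≤a | inj₁ b≤c | inj₂ c≤a = P-swap₁₂ (P-swap₂₃ (sorted b≤c c≤a))
... | inj₂ b≤a | inj₂ c≤b | _        = P-swap₁₂ (P-swap₂₃ (P-swap₁₂ (sorted c≤b b≤a)))

ReachesPSet : Pos → Set
ReachesPSet p = ∃[ q ] ReflClosure Move p q × PSet q

ReachesPSet-swap₁₂ : ReachesPSet p → ReachesPSet (swap₁₂ p)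
ReachesPSet-swap₁₂ (q , p→q , P) = swap₁₂ q , ReflClosure.map Move-swap₁₂ p→q , PSet-swap₁₂ P

ReachesPSet-swap₂₃ : ReachesPSet p → ReachesPSet (swap₂₃ p)
ReachesPSet-swap₂₃ (q , p→q , P) = swap₂₃ q , ReflClosure.map Move-swap₂₃ p→q , PSet-swap₂₃ P

transfer₃₁ : a ≤ a′ → a′ ≤ c′ → a + c ≡ a′ + c′ → ReflClosure Move (a , b , c) (a′ , b , c′)
transfer₃₁ {a} {c′ = c′} a≤a′ a′≤c′ conserved with m≤n⇒∃[o]m+o≡n a≤a′
... | k , refl
  with +-cancelˡ-≡ a _ (c′ + k) (trans conserved (trans (+-assoc a k c′) (cong (a +_) (+-comm k c′))))
...   | refl with k
...     | zero  rewrite +-identityʳ a | +-identityʳ c′ = refl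
...     | suc _ = [ m31 z<s a′≤c′ ]

module _ (x u : ℕ) where

  equalise-low : EvenGap (x + u) (x + u + j) → ReachesPSet (x , x + u , x + u + (u + j))
  equalise-low {j} g = (x + u , x + u , x + u + j) ,
    transfer₃₁ (m≤m+n x u) (m≤m+n (x + u) j) (solve (x ∷ u ∷ j ∷ [])) , twin₁₂ refl g

  ReachesPSet-lowMiddle : ValuationView j → ReachesPSet (x , x + u , x + u + (u + j))
  ReachesPSet-lowMiddle zero        = equalise-low (same (+-identityʳ (x + u)))
  ReachesPSet-lowMiddle (evenVal e) = equalise-low (above e refl)
  ReachesPSet-lowMiddle (oddVal {n} e) = (x + u + n , x + u , x + u + n) ,
    transfer₃₁ (≤-trans (m≤m+n x u) (m≤m+n (x + u) n)) ≤-refl (solve (x ∷ u ∷ n ∷ [])) ,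
    twin₁₃ refl (below e refl)

module _ (x v : ℕ) where

  equalise-high : EvenGap (x + (v + j)) (x + v) → ReachesPSet (x , x + (v + j) , x + (v + j) + v)
  equalise-high {j} g = (x + v , x + (v + j) , x + (v + j)) ,
    transfer₃₁ (m≤m+n x v) (+-monoʳ-≤ x (m≤m+n v j)) (solve (x ∷ v ∷ j ∷ [])) , twin₂₃ refl g

  ReachesPSet-highMiddle : ValuationView j → ReachesPSet (x , x + (v + j) , x + (v + j) + v)
  ReachesPSet-highMiddle zero        = equalise-high (same (cong (x +_) (sym (+-identityʳ v))))
  ReachesPSet-highMiddle (evenVal {j} e) = equalise-high (below e (sym (+-assoc x v j)))
  ReachesPSet-highMiddle (oddVal {n} e) = (x + v + n , x + (v + (n + n)) , x + v + n) ,
    transfer₃₁ (≤-trans (m≤m+n x v) (m≤m+n (x + v) n)) ≤-refl (solve (x ∷ v ∷ n ∷ [])) ,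
    twin₁₃ refl (above e (solve (x ∷ v ∷ n ∷ [])))

ReachesPSet-sorted : a ≤ b → b ≤ c → ReachesPSet (a , b , c)
ReachesPSet-sorted {a} a≤b b≤c with m≤n⇒∃[o]m+o≡n a≤b | m≤n⇒∃[o]m+o≡n b≤c
... | u , refl | v , refl with ≤-total u v
... | inj₁ u≤v with m≤n⇒∃[o]m+o≡n u≤v
...   | j , refl = ReachesPSet-lowMiddle a u (valuationView j)
ReachesPSet-sorted {a} a≤b b≤c | u , refl | v , refl | inj₂ v≤u with m≤n⇒∃[o]m+o≡n v≤u
...   | j , refl = ReachesPSet-highMiddle a v (valuationView j)

reachesPSet : ∀ p → ReachesPSet p
reachesPSet = sorted-elim ReachesPSet ReachesPSet-swap₁₂ ReachesPSet-swap₂₃ ReachesPSet-sorted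

PSet⇒IsP : PSet p → IsP p
PSet⇒IsP P (win q p→q replies) with reachesPSet q
... | _ , refl    , Q = PSet-independent p→q P Q
... | r , [ q→r ] , R = PSet⇒IsP R (replies r q→r)

PSet⊎Win : ∀ p → PSet p ⊎ Win p
PSet⊎Win p = go p (<-wellFounded (sumSq p))
  where
  go : ∀ p → Acc _<_ (sumSq p) → PSet p ⊎ Win p
  go p (acc rs) with reachesPSet p
  ... | _ , refl    , P = inj₁ P
  ... | q , [ p→q ] , Q = inj₂ (win q p→q reply)
    where
    reply : ∀ r → Move q r → Win r
    reply r q→r with go r (rs (<-trans (sumSq-decreasing q→r) (sumSq-decreasing p→q)))
    ... | inj₁ R = ⊥-elim (PSet-independent q→r Q R)
    ... | inj₂ w = w

IsP⇔PSet : IsP p ⇔ PSet p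
IsP⇔PSet {p} = mk⇔ (λ ¬win → fromInj₁ (⊥-elim ∘ ¬win) (PSet⊎Win p)) PSet⇒IsP

EvenGap-translate : ∀ x → EvenGap a b ⇔ EvenGap (x + a) (x + b)
EvenGap-translate {a} {b} x = mk⇔ to from
  where
  to : EvenGap a b → EvenGap (x + a) (x + b)
  to (same eq)            = same (cong (x +_) eq)
  to (above {m} e eq)     = above e (trans (cong (x +_) eq) (sym (+-assoc x a m)))
  to (below {m} e eq)     = below e (trans (cong (x +_) eq) (sym (+-assoc x b m)))
  from : EvenGap (x + a) (x + b) → EvenGap a b
  from (same eq)          = same (+-cancelˡ-≡ x b a eq)
  from (above {m} e eq)   = above e (+-cancelˡ-≡ x b (a + m) (trans eq (+-assoc x a m)))
  from (below {m} e eq)   = below e (+-cancelˡ-≡ x a (b + m) (trans eq (+-assoc x b m)))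

PSet-translate : ∀ x → PSet (a , b , c) ⇔ PSet (x + a , x + b , x + c)
PSet-translate {a} {b} {c} x = mk⇔ to from
  where
  module T {a b} = Equivalence (EvenGap-translate {a} {b} x)
  to : PSet (a , b , c) → PSet (x + a , x + b , x + c)
  to (twin₁₂ eq g) = twin₁₂ (cong (x +_) eq) (T.to g)
  to (twin₁₃ eq g) = twin₁₃ (cong (x +_) eq) (T.to g)
  to (twin₂₃ eq g) = twin₂₃ (cong (x +_) eq) (T.to g)
  from : PSet (x + a , x + b , x + c) → PSet (a , b , c)
  from (twin₁₂ eq g) = twin₁₂ (+-cancelˡ-≡ x a b eq) (T.from g)
  from (twin₁₃ eq g) = twin₁₃ (+-cancelˡ-≡ x a c eq) (T.from g)
  from (twin₂₃ eq g) = twin₂₃ (+-cancelˡ-≡ x b c eq) (T.from g)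

0≢n+EvenVal : EvenVal m → 0 ≢ b + m
0≢n+EvenVal {m} {b} e = <⇒≢ (<-≤-trans (EvenVal-positive e) (m≤n+m m b))

PSet⇒InSet : PSet (0 , b , c) → b ≤ c → InSet (0 , b , c)
PSet⇒InSet (twin₁₂ refl (same refl))    _   = zzz
PSet⇒InSet (twin₁₂ refl (above e refl)) _   = zzm (EvenVal⇒Form e)
PSet⇒InSet (twin₁₂ refl (below e eq))   _   = ⊥-elim (0≢n+EvenVal e eq)
PSet⇒InSet (twin₁₃ refl _)              z≤n = zzz
PSet⇒InSet (twin₂₃ refl (same refl))    _   = zzz
PSet⇒InSet (twin₂₃ refl (above e eq))   _   = ⊥-elim (0≢n+EvenVal e eq)
PSet⇒InSet (twin₂₃ refl (below e refl)) _   = zmm (EvenVal⇒Form e)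

InSet⇒PSet : InSet (0 , b , c) → PSet (0 , b , c)
InSet⇒PSet zzz     = twin₁₂ refl (same refl)
InSet⇒PSet (zzm f) = twin₁₂ refl (above (Form⇒EvenVal f) refl)
InSet⇒PSet (zmm f) = twin₂₃ refl (below (Form⇒EvenVal f) refl)

mainTheorem6 : (x y z : ℕ) → x ≤ y → y ≤ z →
                 (IsP (x , y , z) ⇔ InSet (0 , y ∸ x , z ∸ x))
mainTheorem6 x y z x≤y y≤z =
  ⇔.trans IsP⇔PSet (⇔.trans (⇔.sym shift) (mk⇔ (λ P → PSet⇒InSet P gaps-ordered) InSet⇒PSet))
  where
  gaps-ordered : y ∸ x ≤ z ∸ x
  gaps-ordered = ∸-monoˡ-≤ x y≤z
  offsets : (x + 0 , x + (y ∸ x) , x + (z ∸ x)) ≡ (x , y , z)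
  offsets = cong₂ _,_ (+-identityʳ x) (cong₂ _,_ (m+[n∸m]≡n x≤y) (m+[n∸m]≡n (≤-trans x≤y y≤z)))
  shift : PSet (0 , y ∸ x , z ∸ x) ⇔ PSet (x , y , z)
  shift = subst (λ p → PSet (0 , y ∸ x , z ∸ x) ⇔ PSet p) offsets (PSet-translate x)
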